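{- Let $a\in\mathbb{R}\setminus\{0\}$ and $P\in\mathbb{R}[x,y]$. Let $(x^0_n)_{n\ge1}$ be the solution of $$x_n=a\,x_{\lceil n/2\rceil}+a\,x_{\lfloor n/2\rfloor}+P\big(\lceil n/2\rceil,\lfloor n/2\rfloor\big),\qquad n\ge2,$$ with initial condition $x^0_1=0$. Then for any $x_1\in\mathbb{R}$, the sequence $$\overline{x}_n=x^0_n+\Big((2a)^{q_{s_n}(n)}+(2a-1)\big(n a^{q_{s_n}(n)}-(2a)^{q_{s_n}(n)}\big)\Big)x_1,\qquad n\ge1,$$ is the solution of the same recurrence with initial condition $\overline{x}_1=x_1$.
   Context: For $n\in\mathbb{N}_{\ge1}$ write $n=\sum_{j=1}^{s_n}2^{q_j(n)}$ with $0\le q_1(n)<\cdots<q_{s_n}(n)$ (binary decomposition), so $q_{s_n}(n)=\lfloor\log_2 n\rfloor$. -}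

module Defs where

open import Data.Nat using (ℕ; suc; _≤_; ⌊_/2⌋; ⌈_/2⌉)
open import Data.Nat.Logarithm using (⌊log₂_⌋)
open import Data.List using (List; []; _∷_)
open import Algebra.Bundles using (CommutativeRing; Semiring)
import Algebra.Definitions.RawSemiring as RS

module _ {c ℓ} (R : CommutativeRing c ℓ) where
  open CommutativeRing R
  open RS (Semiring.rawSemiring semiring) using (_×_; _^_)

  -- Bivariate polynomials: a list of rows, row i is the list of coefficients
  -- of x^i y^0, x^i y^1, ...; i.e. P = Σ_i Σ_j c_ij x^i y^j.
  Poly2 : Set c
  Poly2 = List (List Carrier)

  evalY : List Carrier → Carrier → Carrier
  evalY []       y = 0#
  evalY (c ∷ cs) y = c + y * evalY cs y

  evalP : Poly2 → Carrier → Carrier → Carrier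
  evalP []         x y = 0#
  evalP (r ∷ rs)   x y = evalY r y + x * evalP rs x y

  ι : ℕ → Carrier
  ι n = n × 1#

  -- q_{s_n}(n) = ⌊log₂ n⌋, the index of the leading binary digit
  qtop : ℕ → ℕ
  qtop n = ⌊log₂ n ⌋

  -- x (indexed by n ≥ 1; the value at 0 is irrelevant) solves
  -- x_n = a x_{⌈n/2⌉} + a x_{⌊n/2⌋} + P(⌈n/2⌉, ⌊n/2⌋) for all n ≥ 2
  IsSolution : Carrier → Poly2 → (ℕ → Carrier) → Set ℓ
  IsSolution a P x = ∀ n → 2 ≤ n →
    x n ≈ a * x ⌈ n /2⌉ + a * x ⌊ n /2⌋ + evalP P (ι ⌈ n /2⌉) (ι ⌊ n /2⌋)

  coeff : Carrier → ℕ → Carrier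
  coeff a n = ((a + a) ^ qtop n)
            + (a + a - 1#) * (ι n * (a ^ qtop n) - (a + a) ^ qtop n)

{-# OPTIONS --safe #-}
-- The coefficient c_n of x₁ solves the homogeneous recurrence with c_1 = 1, so the claim is a
-- superposition of solutions. Write c_n = F(q_{s_n}(n), n) with
-- F(q, X) = (2a)^q + (2a-1)(X a^q - (2a)^q), affine in X. Then a F(q, X) + a F(q, Y) = F(q+1, X+Y),
-- and for m = ⌊n/2⌋ we have q_{s_n}(n) = q_{s_m}(m) + 1, so the recurrence at n holds once ⌈n/2⌉
-- can also be evaluated with the exponent q_{s_m}(m). That fails only when ⌈n/2⌉ = m + 1 is the
-- power 2^(q+1), q = q_{s_m}(m), and there F(q, 2^(q+1)) = F(q+1, 2^(q+1)) = (2a)^(q+1).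
module Submission where

open import Defs
open import Data.Nat using (ℕ)
open import Data.Product using (_×_)
open import Relation.Nullary using (¬_)
open import Algebra.Bundles using (CommutativeRing; Semiring)

open import Data.Nat.Base as Nat using (zero; suc; s≤s; _∸_; _≤_; _<_; NonZero; >-nonZero⁻¹; ⌊_/2⌋; ⌈_/2⌉)
open import Data.Nat.Properties
  using ( ≤-refl; ≤-trans; ≤-antisym; _≤?_; _<?_; ≰⇒>; ≮⇒≥; <-irrefl; module ≤-Reasoning
        ; m+[n∸m]≡n; ∸-monoˡ-≤; +-monoʳ-≤; *-monoʳ-≤; ^-monoʳ-≤; n≤1+n; ⌊n/2⌋≤⌈n/2⌉; ⌊n/2⌋+⌈n/2⌉≡n)
  renaming (+-comm to ℕ+-comm; +-identityʳ to ℕ+-identityʳ)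
open import Data.Nat.Logarithm
open import Data.Product using (_,_)
open import Data.Sum using (_⊎_; inj₁; inj₂; [_,_]′)
open import Data.List using ([])
open import Data.Maybe using (nothing)
open import Relation.Nullary using (yes; no; contradiction)
open import Relation.Binary.PropositionalEquality as ≡ using (_≡_; cong)
import Algebra.Definitions.RawSemiring as RawSemiring
import Algebra.Properties.Monoid.Mult as MonoidMult
import Relation.Binary.Reasoning.Setoid as SetoidReasoning

⌊log₂n⌋≡1+⌊log₂⌊n/2⌋⌋ : ∀ n → 2 ≤ n → ⌊log₂ n ⌋ ≡ suc ⌊log₂ ⌊ n /2⌋ ⌋
⌊log₂n⌋≡1+⌊log₂⌊n/2⌋⌋ n 2≤n = begin-equality
  ⌊log₂ n ⌋                 ≡⟨ m+[n∸m]≡n 1≤⌊log₂n⌋ ⟨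
  suc (⌊log₂ n ⌋ ∸ 1)       ≡⟨ cong suc (⌊log₂⌊n/2⌋⌋≡⌊log₂n⌋∸1 n) ⟨
  suc ⌊log₂ ⌊ n /2⌋ ⌋       ∎
  where
  open ≤-Reasoning
  1≤⌊log₂n⌋ : 1 ≤ ⌊log₂ n ⌋
  1≤⌊log₂n⌋ = ≡.subst (_≤ ⌊log₂ n ⌋) (⌊log₂[2^n]⌋≡n 1) (⌊log₂⌋-mono-≤ 2≤n)

2*⌊n/2⌋≤n : ∀ n → 2 Nat.* ⌊ n /2⌋ ≤ n
2*⌊n/2⌋≤n n = begin
  ⌊ n /2⌋ Nat.+ (⌊ n /2⌋ Nat.+ 0)  ≡⟨ cong (⌊ n /2⌋ Nat.+_) (ℕ+-identityʳ ⌊ n /2⌋) ⟩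
  ⌊ n /2⌋ Nat.+ ⌊ n /2⌋             ≤⟨ +-monoʳ-≤ ⌊ n /2⌋ (⌊n/2⌋≤⌈n/2⌉ n) ⟩
  ⌊ n /2⌋ Nat.+ ⌈ n /2⌉             ≡⟨ ⌊n/2⌋+⌈n/2⌉≡n n ⟩
  n                                 ∎
  where open ≤-Reasoning

2^k≤n : ∀ k n .{{_ : NonZero n}} → k ≤ ⌊log₂ n ⌋ → 2 Nat.^ k ≤ n
2^k≤n zero    n                _    = >-nonZero⁻¹ n
2^k≤n (suc k) 1                k<⌊log₂1⌋ with () ← ≡.subst (suc k ≤_) (⌊log₂[2^n]⌋≡n 0) k<⌊log₂1⌋
2^k≤n (suc k) n@(suc (suc _)) k<⌊log₂n⌋ =
  ≤-trans (*-monoʳ-≤ 2 (2^k≤n k ⌊ n /2⌋ k≤⌊log₂⌊n/2⌋⌋)) (2*⌊n/2⌋≤n n)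
  where
  k≤⌊log₂⌊n/2⌋⌋ : k ≤ ⌊log₂ ⌊ n /2⌋ ⌋
  k≤⌊log₂⌊n/2⌋⌋ = ≡.subst (k ≤_) (≡.sym (⌊log₂⌊n/2⌋⌋≡⌊log₂n⌋∸1 n)) (∸-monoˡ-≤ 1 k<⌊log₂n⌋)

2^⌊log₂n⌋≤n : ∀ n .{{_ : NonZero n}} → 2 Nat.^ ⌊log₂ n ⌋ ≤ n
2^⌊log₂n⌋≤n n = 2^k≤n ⌊log₂ n ⌋ n ≤-refl

n<2^[1+⌊log₂n⌋] : ∀ n → n < 2 Nat.^ suc ⌊log₂ n ⌋
n<2^[1+⌊log₂n⌋] n with n <? 2 Nat.^ suc ⌊log₂ n ⌋
... | yes n<2^ = n<2^
... | no n≮2^ = contradiction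
  (≡.subst (_≤ ⌊log₂ n ⌋) (⌊log₂[2^n]⌋≡n (suc ⌊log₂ n ⌋)) (⌊log₂⌋-mono-≤ (≮⇒≥ n≮2^)))
  (<-irrefl ≡.refl)

⌊log₂[1+n]⌋≡⌊log₂n⌋⊎1+n≡2^ : ∀ n .{{_ : NonZero n}} →
  ⌊log₂ suc n ⌋ ≡ ⌊log₂ n ⌋ ⊎ suc n ≡ 2 Nat.^ suc ⌊log₂ n ⌋
⌊log₂[1+n]⌋≡⌊log₂n⌋⊎1+n≡2^ n with ⌊log₂ suc n ⌋ ≤? ⌊log₂ n ⌋
... | yes ≤′ = inj₁ (≤-antisym ≤′ (⌊log₂⌋-mono-≤ (n≤1+n n)))
... | no ≰′ = inj₂ (≤-antisym (n<2^[1+⌊log₂n⌋] n)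
                    (≤-trans (^-monoʳ-≤ 2 (≰⇒> ≰′)) (2^⌊log₂n⌋≤n (suc n))))

⌈n/2⌉≡⌊n/2⌋⊎⌈n/2⌉≡1+⌊n/2⌋ : ∀ n → ⌈ n /2⌉ ≡ ⌊ n /2⌋ ⊎ ⌈ n /2⌉ ≡ suc ⌊ n /2⌋
⌈n/2⌉≡⌊n/2⌋⊎⌈n/2⌉≡1+⌊n/2⌋ zero          = inj₁ ≡.refl
⌈n/2⌉≡⌊n/2⌋⊎⌈n/2⌉≡1+⌊n/2⌋ (suc zero)    = inj₂ ≡.refl
⌈n/2⌉≡⌊n/2⌋⊎⌈n/2⌉≡1+⌊n/2⌋ (suc (suc n)) with ⌈n/2⌉≡⌊n/2⌋⊎⌈n/2⌉≡1+⌊n/2⌋ n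
... | inj₁ eq = inj₁ (cong suc eq)
... | inj₂ eq = inj₂ (cong suc eq)

module _ {c ℓ} (R : CommutativeRing c ℓ) where
  open CommutativeRing R
  open RawSemiring (Semiring.rawSemiring semiring) using (_^_)
  open import Algebra.Solver.Ring.NaturalCoefficients commutativeSemiring (λ _ _ → nothing)
  open import Algebra.Properties.Ring ring using ([y-z]x≈yx-zx; -‿distribʳ-*)
  open import Algebra.Properties.AbelianGroup +-abelianGroup using (xyx⁻¹≈y)
  open SetoidReasoning setoid

  ι-+ : ∀ m n → ι R (m Nat.+ n) ≈ ι R m + ι R n
  ι-+ m n = MonoidMult.×-homo-+ +-monoid 1# m n

  ι-double : ∀ n → ι R (2 Nat.* n) ≈ ι R n + ι R n
  ι-double n = trans (ι-+ n (n Nat.+ 0)) (+-congˡ (trans (ι-+ n 0) (+-identityʳ (ι R n))))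

  ι[2^k]*x^k≈[x+x]^k : ∀ x k → ι R (2 Nat.^ k) * x ^ k ≈ (x + x) ^ k
  ι[2^k]*x^k≈[x+x]^k x zero    = trans (*-identityʳ (1# + 0#)) (+-identityʳ 1#)
  ι[2^k]*x^k≈[x+x]^k x (suc k) = begin
    ι R (2 Nat.* 2 Nat.^ k) * (x * x ^ k)  ≈⟨ *-congʳ (ι-double (2 Nat.^ k)) ⟩
    (p + p) * (x * x ^ k)                  ≈⟨ solve 3 (λ x p A → (p :+ p) :* (x :* A) := (x :+ x) :* (p :* A))
                                                      refl x p (x ^ k) ⟩
    (x + x) * (p * x ^ k)                  ≈⟨ *-congˡ (ι[2^k]*x^k≈[x+x]^k x k) ⟩
    (x + x) * (x + x) ^ k                  ∎
    where p = ι R (2 Nat.^ k)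

  x+[y-1]*x≈y*x : ∀ x y → x + (y - 1#) * x ≈ y * x
  x+[y-1]*x≈y*x x y = begin
    x + (y - 1#) * x        ≈⟨ +-congˡ ([y-z]x≈yx-zx x y 1#) ⟩
    x + (y * x - 1# * x)    ≈⟨ +-congˡ (+-congˡ (-‿cong (*-identityˡ x))) ⟩
    x + (y * x - x)         ≈⟨ +-assoc x (y * x) (- x) ⟨
    x + y * x - x           ≈⟨ xyx⁻¹≈y x (y * x) ⟩
    y * x                   ∎

  module _ (a : Carrier) where

    coeffAt : ℕ → Carrier → Carrier
    coeffAt q X = (a + a) ^ q + (a + a - 1#) * (X * a ^ q - (a + a) ^ q)

    coeffAt-congʳ : ∀ q {X Y} → X ≈ Y → coeffAt q X ≈ coeffAt q Y
    coeffAt-congʳ q X≈Y = +-congˡ (*-congˡ (+-congʳ (*-congʳ X≈Y)))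

    coeffAt-suc : ∀ q X Y → a * coeffAt q X + a * coeffAt q Y ≈ coeffAt (suc q) (X + Y)
    coeffAt-suc q X Y = trans
      (solve 7 (λ a d A B -B X Y →
                  a :* (B :+ d :* (X :* A :+ -B)) :+ a :* (B :+ d :* (Y :* A :+ -B))
                  := (a :+ a) :* B :+ d :* ((X :+ Y) :* (a :* A) :+ (a :+ a) :* -B))
        refl a (a + a - 1#) (a ^ q) B (- B) X Y)
      (+-congˡ (*-congˡ (+-congˡ (sym (-‿distribʳ-* (a + a) B)))))
      where B = (a + a) ^ q

    coeffAt-2^ : ∀ q → coeffAt q (ι R (2 Nat.^ q)) ≈ (a + a) ^ q
    coeffAt-2^ q = begin
      B + d * (ι R (2 Nat.^ q) * a ^ q - B)  ≈⟨ +-congˡ (*-congˡ (+-congʳ (ι[2^k]*x^k≈[x+x]^k a q))) ⟩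
      B + d * (B - B)                        ≈⟨ +-congˡ (*-congˡ (-‿inverseʳ B)) ⟩
      B + d * 0#                             ≈⟨ +-congˡ (zeroʳ d) ⟩
      B + 0#                                 ≈⟨ +-identityʳ B ⟩
      B                                      ∎
      where B = (a + a) ^ q; d = a + a - 1#

    coeffAt-2^suc : ∀ q → coeffAt q (ι R (2 Nat.^ suc q)) ≈ (a + a) ^ suc q
    coeffAt-2^suc q = begin
      coeffAt q (ι R (2 Nat.* 2 Nat.^ q)) ≈⟨ coeffAt-congʳ q (ι-double (2 Nat.^ q)) ⟩
      B + d * ((p + p) * A - B)           ≈⟨ +-congˡ (*-congˡ (+-congʳ [p+p]*A≈B+B)) ⟩
      B + d * (B + B - B)                 ≈⟨ +-congˡ (*-congˡ (xyx⁻¹≈y B B)) ⟩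
      B + d * B                           ≈⟨ x+[y-1]*x≈y*x B (a + a) ⟩
      (a + a) * B                         ∎
      where
      p = ι R (2 Nat.^ q); A = a ^ q; B = (a + a) ^ q; d = a + a - 1#
      [p+p]*A≈B+B : (p + p) * A ≈ B + B
      [p+p]*A≈B+B = trans (distribʳ A p p) (+-cong (ι[2^k]*x^k≈[x+x]^k a q) (ι[2^k]*x^k≈[x+x]^k a q))

    coeff-2^ : ∀ k → coeff R a (2 Nat.^ k) ≈ (a + a) ^ k
    coeff-2^ k = trans (reflexive (cong (λ q → coeffAt q (ι R (2 Nat.^ k))) (⌊log₂[2^n]⌋≡n k))) (coeffAt-2^ k)

    coeff-1+n : ∀ n .{{_ : NonZero n}} → coeff R a (suc n) ≈ coeffAt ⌊log₂ n ⌋ (ι R (suc n))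
    coeff-1+n n with ⌊log₂[1+n]⌋≡⌊log₂n⌋⊎1+n≡2^ n
    ... | inj₁ eq = reflexive (cong (λ q → coeffAt q (ι R (suc n))) eq)
    ... | inj₂ eq = begin
      coeff R a (suc n)                ≡⟨ cong (coeff R a) eq ⟩
      coeff R a (2 Nat.^ suc Q)        ≈⟨ coeff-2^ (suc Q) ⟩
      (a + a) ^ suc Q                  ≈⟨ coeffAt-2^suc Q ⟨
      coeffAt Q (ι R (2 Nat.^ suc Q))  ≡⟨ cong (λ m → coeffAt Q (ι R m)) eq ⟨
      coeffAt Q (ι R (suc n))          ∎
      where Q = ⌊log₂ n ⌋

    coeff-⌈n/2⌉ : ∀ n .{{_ : NonZero ⌊ n /2⌋}} →
      coeff R a ⌈ n /2⌉ ≈ coeffAt ⌊log₂ ⌊ n /2⌋ ⌋ (ι R ⌈ n /2⌉)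
    coeff-⌈n/2⌉ n = [ (λ eq → ≡.subst AgreesAt (≡.sym eq) refl)
                    , (λ eq → ≡.subst AgreesAt (≡.sym eq) (coeff-1+n ⌊ n /2⌋))
                    ]′ (⌈n/2⌉≡⌊n/2⌋⊎⌈n/2⌉≡1+⌊n/2⌋ n)
      where
      AgreesAt : ℕ → Set ℓ
      AgreesAt m = coeff R a m ≈ coeffAt ⌊log₂ ⌊ n /2⌋ ⌋ (ι R m)

    coeff-isSolution : IsSolution R a [] (coeff R a)
    coeff-isSolution 0 ()
    coeff-isSolution 1 (s≤s ())
    coeff-isSolution n@(suc (suc _)) 2≤n = begin
      coeff R a n                                                  ≡⟨ cong (λ q → coeffAt q (ι R n))
                                                                           (⌊log₂n⌋≡1+⌊log₂⌊n/2⌋⌋ n 2≤n) ⟩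
      coeffAt (suc Q) (ι R n)                                      ≈⟨ coeffAt-congʳ (suc Q) ι[n]≈ι⌈n/2⌉+ι⌊n/2⌋ ⟩
      coeffAt (suc Q) (ι R ⌈ n /2⌉ + ι R ⌊ n /2⌋)                  ≈⟨ coeffAt-suc Q (ι R ⌈ n /2⌉) (ι R ⌊ n /2⌋) ⟨
      a * coeffAt Q (ι R ⌈ n /2⌉) + a * coeffAt Q (ι R ⌊ n /2⌋)    ≈⟨ +-congʳ (*-congˡ (coeff-⌈n/2⌉ n)) ⟨
      a * coeff R a ⌈ n /2⌉ + a * coeff R a ⌊ n /2⌋                 ≈⟨ +-identityʳ _ ⟨
      a * coeff R a ⌈ n /2⌉ + a * coeff R a ⌊ n /2⌋ + 0#            ∎
      where
      Q = ⌊log₂ ⌊ n /2⌋ ⌋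
      ι[n]≈ι⌈n/2⌉+ι⌊n/2⌋ : ι R n ≈ ι R ⌈ n /2⌉ + ι R ⌊ n /2⌋
      ι[n]≈ι⌈n/2⌉+ι⌊n/2⌋ = trans (reflexive (cong (ι R) (≡.sym ⌈n/2⌉+⌊n/2⌋≡n))) (ι-+ ⌈ n /2⌉ ⌊ n /2⌋)
        where
        ⌈n/2⌉+⌊n/2⌋≡n : ⌈ n /2⌉ Nat.+ ⌊ n /2⌋ ≡ n
        ⌈n/2⌉+⌊n/2⌋≡n = ≡.trans (ℕ+-comm ⌈ n /2⌉ ⌊ n /2⌋) (⌊n/2⌋+⌈n/2⌉≡n n)

    superpose : ∀ P x y → IsSolution R a P x → IsSolution R a [] y →
      ∀ t → IsSolution R a P (λ n → x n + y n * t)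
    superpose P x y x-sol y-sol t n 2≤n = trans
      (+-cong (x-sol n 2≤n) (*-congʳ (trans (y-sol n 2≤n) (+-identityʳ _))))
      (solve 7 (λ a u v e c d t → (a :* u :+ a :* v :+ e) :+ (a :* c :+ a :* d) :* t
                                  := a :* (u :+ c :* t) :+ a :* (v :+ d :* t) :+ e)
        refl a (x ⌈ n /2⌉) (x ⌊ n /2⌋) (evalP R P (ι R ⌈ n /2⌉) (ι R ⌊ n /2⌋))
        (y ⌈ n /2⌉) (y ⌊ n /2⌋) t)

    initial-value : ∀ {u} → u ≈ 0# → ∀ t → u + coeff R a 1 * t ≈ t
    initial-value u≈0 t = begin
      _ + coeff R a 1 * t  ≈⟨ +-cong u≈0 (*-congʳ (coeff-2^ 0)) ⟩
      0# + 1# * t          ≈⟨ +-identityˡ _ ⟩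
      1# * t               ≈⟨ *-identityˡ t ⟩
      t                    ∎

lemma5 : ∀ {c ℓ} (R : CommutativeRing c ℓ) →
    let open CommutativeRing R in
    (a : Carrier) → ¬ (a ≈ 0#) → (P : Poly2 R) →
    (x⁰ : ℕ → Carrier) → IsSolution R a P x⁰ → x⁰ 1 ≈ 0# →
    (x₁ : Carrier) →
    IsSolution R a P (λ n → x⁰ n + coeff R a n * x₁)
    × ((x⁰ 1 + coeff R a 1 * x₁) ≈ x₁)
lemma5 R a _ P x⁰ x⁰-isSolution x⁰₁≈0 x₁ =
  superpose R a P x⁰ (coeff R a) x⁰-isSolution (coeff-isSolution R a) x₁ , initial-value R a x⁰₁≈0 x₁
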